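{- Let $B(r)$ be the $r$-dimensional Benes network, $r\geq 1$. Then $SSPC_{2U}(B(r))\leq \left\lceil \frac{r}{2}\right\rceil 2^{r}$.
   Context: The $r$-dimensional Benes network $B(r)$ (two back-to-back butterflies) has vertex set $\{[w,i]: w\in\{0,1\}^r,\ 0\leq i\leq 2r\}$; for $0\leq i<r$, $[w,i]$ is adjacent to $[w',i+1]$ iff $w'=w$ or $w,w'$ differ exactly in the $(i+1)$-th bit, and for $r\leq i<2r$, $[w,i]$ is adjacent to $[w',i+1]$ iff $w'=w$ or $w,w'$ differ exactly in the $(2r-i)$-th bit; there are no other edges. For a graph $G$ with distance $d$, a set $S\subseteq V(G)$ is a $2$-strong shortest path union cover if one can choose, for each $u\in S$ and each $v\in V(G)$ with $d(u,v)\leq 2$, a single shortest $u$–$v$ path $P(u,v)$ such that the union of the edge sets of all chosen paths equals $E(G)$; $SSPC_{2U}(G)$ is the minimum cardinality of such a set. -}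

module Defs where

open import Data.Nat using (ℕ; zero; suc; _+_; _*_; _∸_; _^_; _≤_; _<_; _<?_)
open import Relation.Nullary using (yes; no)
open import Data.Nat.Base using (⌈_/2⌉)
open import Data.Bool using (Bool)
open import Data.Fin using (Fin; toℕ)
open import Data.Vec using (Vec; lookup)
open import Data.List using (List; []; _∷_; _++_; length)
open import Data.List.Membership.Propositional using (_∈_)
open import Data.List.Relation.Unary.Unique.Propositional using (Unique)
open import Data.Product using (Σ; ∃; _×_; _,_)
open import Data.Sum using (_⊎_)
open import Relation.Binary.PropositionalEquality using (_≡_; _≢_)

module _ {V : Set} (Adj : V → V → Set) where

  -- A walk from x to z, as the list of its vertices (x first, z last),
  -- consecutive vertices adjacent.  Its length (number of edges) is
  -- (number of listed vertices) - 1.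
  data IsWalk : V → List V → V → Set where
    single : ∀ {x} → IsWalk x (x ∷ []) x
    step   : ∀ {x y ys z} → Adj x y → IsWalk y ys z → IsWalk x (x ∷ ys) z

  DistLe : ℕ → V → V → Set
  DistLe k u v = ∃ λ ys → IsWalk u ys v × length ys ≤ suc k

  ShortestPath : V → V → List V → Set
  ShortestPath u v xs =
    IsWalk u xs v × (∀ ys → IsWalk u ys v → length xs ≤ length ys)

  EdgeOf : V → V → List V → Set
  EdgeOf x y xs = ∃ λ pre → ∃ λ post →
    (xs ≡ pre ++ x ∷ y ∷ post) ⊎ (xs ≡ pre ++ y ∷ x ∷ post)

  Is2SSPUnionCover : List V → Set
  Is2SSPUnionCover S =
    Σ (V → V → List V) λ P →
      (∀ u v → u ∈ S → DistLe 2 u v → ShortestPath u v (P u v))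
      × (∀ x y → Adj x y →
           ∃ λ u → ∃ λ v → u ∈ S × DistLe 2 u v × EdgeOf x y (P u v))

  SSPC2U≤ : ℕ → Set
  SSPC2U≤ k = ∃ λ S → Unique S × Is2SSPUnionCover S × length S ≤ k

-- The r-dimensional Benes network B(r).
-- Vertex [w,i] with w ∈ {0,1}^r and 0 ≤ i ≤ 2r.
-- Bits are 1-indexed in the paper; bit number b corresponds to
-- the Fin index with toℕ = b - 1.

BenesV : ℕ → Set
BenesV r = Vec Bool r × Fin (suc (r + r))

DiffExactlyAt : ∀ {r} → Vec Bool r → Vec Bool r → ℕ → Set
DiffExactlyAt {r} w w' m =
  (k : Fin r) → (toℕ k ≡ m → lookup w k ≢ lookup w' k)
              × (toℕ k ≢ m → lookup w k ≡ lookup w' k)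

flipIndex : ℕ → ℕ → ℕ
flipIndex r i with i <? r
... | yes _ = i                -- bit i+1 (1-based)
... | no  _ = (r + r) ∸ suc i  -- bit 2r-i (1-based)

BenesArc : ∀ r → BenesV r → BenesV r → Set
BenesArc r (w , i) (w' , j) =
  toℕ j ≡ suc (toℕ i) × (w' ≡ w ⊎ DiffExactlyAt w w' (flipIndex r (toℕ i)))

BenesAdj : ∀ r → BenesV r → BenesV r → Set
BenesAdj r x y = BenesArc r x y ⊎ BenesArc r y x

-- Let S consist of all vertices on the levels 4k + 2 ≤ 2r: these are ⌈r/2⌉ levels of 2^r
-- vertices each.  Write the lower level of an edge as 4k + ρ with ρ < 4.  For ρ = 1, 2 the edge
-- has an endpoint in S.  For ρ = 0, 3 it continues a straight (word-preserving) edge from a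
-- vertex u ∈ S two levels away, so it lies on a shortest path of length 2 starting at u.  Choosing
-- every length-2 path through a straight neighbour of its start whenever possible makes this the
-- chosen path, since a vertex has only one straight neighbour on each adjacent level.
module Submission where

open import Defs
open import Data.Nat using (ℕ; _*_; _^_; _≤_)
open import Data.Nat.Base using (⌈_/2⌉)

open import Data.Nat using (zero; suc; _+_; _<_; s≤s; z≤n)
open import Data.Nat.Properties
  using ( ≤-pred; 1+n≢n; m≢1+n+m; ≤-refl; ≤-reflexive; ≤-trans; ≤-<-trans
        ; <⇒≱; ≰⇒>; m≤n+m; +-mono-≤; +-cancelˡ-≡; *-cancelʳ-≡; *-comm
        ; ⌈n/2⌉-mono; n≡⌊n+n/2⌋; n≡⌈n+n/2⌉)
  renaming (_≟_ to _≟ℕ_)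
open import Data.Nat.DivMod using (DivMod; result; _divMod_)
open import Data.Nat.Tactic.RingSolver using (solve-∀)
open import Data.Bool using (Bool; true; false)
open import Data.Bool.Properties using () renaming (_≟_ to _≟B_)
open import Data.Fin using (Fin; toℕ; fromℕ<)
open import Data.Fin.Patterns using (0F; 1F; 2F; 3F)
open import Data.Fin.Properties using (toℕ-fromℕ<; toℕ<n; toℕ-injective; all?; any?)
  renaming (_≟_ to _≟F_)
open import Data.Fin.Subset.Properties using (anySubset?)
open import Data.Vec using (Vec; []; _∷_; lookup)
open import Data.Vec.Properties using (∷-injective) renaming (≡-dec to ≡-decVec)
open import Data.List using (List; []; _∷_; length; map; cartesianProductWith; allFin)
open import Data.List.Properties using (length-++; length-map; length-tabulate)
open import Data.List.Membership.Propositional using (_∈_)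
open import Data.List.Membership.Propositional.Properties
  using (∈-cartesianProductWith⁺; ∈-allFin)
open import Data.List.Relation.Unary.Any using (here; there)
open import Data.List.Relation.Unary.Unique.Propositional using (Unique)
import Data.List.Relation.Unary.Unique.Propositional.Properties as Unique
import Data.List.Relation.Unary.AllPairs as AllPairs
import Data.List.Relation.Unary.All as All
open import Data.Product using (∃; _×_; _,_; proj₁)
open import Data.Product.Properties using (,-injectiveˡ; ,-injectiveʳ) renaming (≡-dec to ≡-dec×)
open import Data.Sum using (inj₁; inj₂; swap)
open import Data.Empty using (⊥-elim)
open import Level using (0ℓ)
open import Relation.Nullary using (¬_; Dec; yes; no; ¬?)
open import Relation.Nullary.Decidable using (_×-dec_; _⊎-dec_; _→-dec_; map′)
open import Relation.Unary using (Pred) renaming (Decidable to Decidable₁)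
open import Relation.Binary using (Decidable; DecidableEquality)
open import Relation.Binary.PropositionalEquality
  using (_≡_; _≢_; refl; sym; trans; cong; cong₂; subst)

m+m<n⇒m<⌈n/2⌉ : ∀ {m n} → m + m < n → m < ⌈ n /2⌉
m+m<n⇒m<⌈n/2⌉ {m} m+m<n = ≤-trans (s≤s (≤-reflexive (n≡⌊n+n/2⌋ m))) (⌈n/2⌉-mono m+m<n)

m<⌈n/2⌉⇒m+m<n : ∀ {m n} → m < ⌈ n /2⌉ → m + m < n
m<⌈n/2⌉⇒m+m<n {m} m<⌈n/2⌉ = ≰⇒> λ n≤m+m →
  <⇒≱ m<⌈n/2⌉ (≤-trans (⌈n/2⌉-mono n≤m+m) (≤-reflexive (sym (n≡⌈n+n/2⌉ m))))

m*4≡[m+m]+[m+m] : ∀ m → m * 4 ≡ (m + m) + (m + m)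
m*4≡[m+m]+[m+m] = solve-∀

2+m*4≡[1+m+m]+[1+m+m] : ∀ m → 2 + m * 4 ≡ suc (m + m) + suc (m + m)
2+m*4≡[1+m+m]+[1+m+m] = solve-∀

length-cartesianProductWith : ∀ {A B C : Set} (f : A → B → C) xs ys →
  length (cartesianProductWith f xs ys) ≡ length xs * length ys
length-cartesianProductWith f [] ys = refl
length-cartesianProductWith f (x ∷ xs) ys = trans (length-++ (map (f x) ys))
  (cong₂ _+_ (length-map (f x) ys) (length-cartesianProductWith f xs ys))

bits : List Bool
bits = true ∷ false ∷ []

∈-bits : ∀ b → b ∈ bits
∈-bits true  = here refl
∈-bits false = there (here refl)

allWords : ∀ n → List (Vec Bool n)
allWords zero    = [] ∷ []
allWords (suc n) = cartesianProductWith _∷_ bits (allWords n)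

length-allWords : ∀ n → length (allWords n) ≡ 2 ^ n
length-allWords zero    = refl
length-allWords (suc n) = trans (length-cartesianProductWith _∷_ bits (allWords n))
                                (cong (2 *_) (length-allWords n))

allWords-unique : ∀ n → Unique (allWords n)
allWords-unique zero    = All.[] AllPairs.∷ AllPairs.[]
allWords-unique (suc n) = Unique.cartesianProductWith⁺ _∷_ ∷-injective
  (((λ ()) All.∷ All.[]) AllPairs.∷ All.[] AllPairs.∷ AllPairs.[]) (allWords-unique n)

∈-allWords : ∀ {n} (w : Vec Bool n) → w ∈ allWords n
∈-allWords []      = here refl
∈-allWords (b ∷ w) = ∈-cartesianProductWith⁺ _∷_ (∈-bits b) (∈-allWords w)

CommonNeighbour : {V : Set} → (V → V → Set) → V → V → V → Set
CommonNeighbour Adj u v m = Adj u m × Adj m v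

module _ {V : Set} {Adj : V → V → Set} where

  walk-length≥1 : ∀ {u ys v} → IsWalk Adj u ys v → 1 ≤ length ys
  walk-length≥1 single     = s≤s z≤n
  walk-length≥1 (step _ _) = s≤s z≤n

  walk-length≥2 : ∀ {u ys v} → u ≢ v → IsWalk Adj u ys v → 2 ≤ length ys
  walk-length≥2 u≢v single        = ⊥-elim (u≢v refl)
  walk-length≥2 u≢v (step _ walk) = s≤s (walk-length≥1 walk)

  walk-length≥3 : ∀ {u ys v} → u ≢ v → ¬ Adj u v → IsWalk Adj u ys v → 3 ≤ length ys
  walk-length≥3 u≢v ¬uv single                 = ⊥-elim (u≢v refl)
  walk-length≥3 u≢v ¬uv (step uv single)       = ⊥-elim (¬uv uv)
  walk-length≥3 u≢v ¬uv (step _ (step _ walk)) = s≤s (s≤s (walk-length≥1 walk))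

  walk-length≤3⇒commonNeighbour : ∀ {u ys v} → u ≢ v → ¬ Adj u v →
    IsWalk Adj u ys v → length ys ≤ 3 → ∃ (CommonNeighbour Adj u v)
  walk-length≤3⇒commonNeighbour u≢v ¬uv single _ = ⊥-elim (u≢v refl)
  walk-length≤3⇒commonNeighbour u≢v ¬uv (step uv single) _ = ⊥-elim (¬uv uv)
  walk-length≤3⇒commonNeighbour u≢v ¬uv (step um (step mv single)) _ = _ , um , mv
  walk-length≤3⇒commonNeighbour u≢v ¬uv (step _ (step _ (step _ walk))) (s≤s (s≤s (s≤s ≤0))) =
    ⊥-elim (<⇒≱ (walk-length≥1 walk) ≤0)

  distLe-adjacent : ∀ {u v} → Adj u v → DistLe Adj 2 u v
  distLe-adjacent uv = _ , step uv single , s≤s (s≤s z≤n)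

  distLe-commonNeighbour : ∀ {u m v} → CommonNeighbour Adj u v m → DistLe Adj 2 u v
  distLe-commonNeighbour (um , mv) = _ , step um (step mv single) , ≤-refl

module ShortestPathChoice
  {V : Set} (Adj : V → V → Set)
  (_≟_ : DecidableEquality V) (adj? : Decidable Adj)
  (search : ∀ {P : Pred V 0ℓ} → Decidable₁ P → Dec (∃ P))
  (Preferred : V → V → V → Set) (preferred? : ∀ u v → Decidable₁ (Preferred u v))
  where

  PreferredMid : V → V → V → Set
  PreferredMid u v m = CommonNeighbour Adj u v m × Preferred u v m

  commonNeighbour? : ∀ u v → Dec (∃ (CommonNeighbour Adj u v))
  commonNeighbour? u v = search λ m → adj? u m ×-dec adj? m v

  preferredMid? : ∀ u v → Dec (∃ (PreferredMid u v))
  preferredMid? u v = search λ m → (adj? u m ×-dec adj? m v) ×-dec preferred? u v m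

  abstract
    -- The last clause (d(u,v) > 2) is a placeholder: such paths are never constrained.
    choosePath : V → V → List V
    choosePath u v with u ≟ v | adj? u v | preferredMid? u v | commonNeighbour? u v
    ... | yes _ | _     | _           | _           = u ∷ []
    ... | no _  | yes _ | _           | _           = u ∷ v ∷ []
    ... | no _  | no _  | yes (m , _) | _           = u ∷ m ∷ v ∷ []
    ... | no _  | no _  | no _        | yes (m , _) = u ∷ m ∷ v ∷ []
    ... | no _  | no _  | no _        | no _        = u ∷ []

    choosePath-shortest : ∀ {u v} → DistLe Adj 2 u v → ShortestPath Adj u v (choosePath u v)
    choosePath-shortest {u} {v} (_ , walk , short)
      with u ≟ v | adj? u v | preferredMid? u v | commonNeighbour? u v
    ... | yes refl | _ | _ | _ = single , λ _ → walk-length≥1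
    ... | no u≢v | yes uv | _ | _ = step uv single , λ _ → walk-length≥2 u≢v
    ... | no u≢v | no ¬uv | yes (_ , (um , mv) , _) | _ =
      step um (step mv single) , λ _ → walk-length≥3 u≢v ¬uv
    ... | no u≢v | no ¬uv | no _ | yes (_ , um , mv) =
      step um (step mv single) , λ _ → walk-length≥3 u≢v ¬uv
    ... | no u≢v | no ¬uv | no _ | no ¬mid =
      ⊥-elim (¬mid (walk-length≤3⇒commonNeighbour u≢v ¬uv walk short))

    choosePath-adjacent : ∀ {u v} → u ≢ v → Adj u v → choosePath u v ≡ u ∷ v ∷ []
    choosePath-adjacent {u} {v} u≢v uv
      with u ≟ v | adj? u v | preferredMid? u v | commonNeighbour? u v
    ... | yes u≡v | _ | _ | _ = ⊥-elim (u≢v u≡v)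
    ... | no _ | yes _  | _ | _ = refl
    ... | no _ | no ¬uv | _ | _ = ⊥-elim (¬uv uv)

    choosePath-uniquePreferred : ∀ {u v m} → u ≢ v → ¬ Adj u v → PreferredMid u v m →
      (∀ {m′} → PreferredMid u v m′ → m′ ≡ m) → choosePath u v ≡ u ∷ m ∷ v ∷ []
    choosePath-uniquePreferred {u} {v} u≢v ¬uv pm unique
      with u ≟ v | adj? u v | preferredMid? u v | commonNeighbour? u v
    ... | yes u≡v | _ | _ | _ = ⊥-elim (u≢v u≡v)
    ... | no _ | yes uv | _ | _ = ⊥-elim (¬uv uv)
    ... | no _ | no _ | yes (_ , pm′) | _ = cong (λ m′ → u ∷ m′ ∷ v ∷ []) (unique pm′)
    ... | no _ | no _ | no ¬pm | _ = ⊥-elim (¬pm (_ , pm))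

  module Covering (S : List V) where

    Covers : V → V → Set
    Covers x y = ∃ λ u → ∃ λ v → u ∈ S × DistLe Adj 2 u v × EdgeOf Adj x y (choosePath u v)

    covers-sym : ∀ {x y} → Covers y x → Covers x y
    covers-sym (u , v , u∈S , d , pre , post , e) = u , v , u∈S , d , pre , post , swap e

    covers-incident : ∀ {u v} → u ∈ S → u ≢ v → Adj u v → Covers u v
    covers-incident u∈S u≢v uv =
      _ , _ , u∈S , distLe-adjacent uv , [] , [] , inj₁ (choosePath-adjacent u≢v uv)

    covers-uniquePreferred : ∀ {u m z} → u ∈ S → u ≢ z → ¬ Adj u z → PreferredMid u z m →
      (∀ {m′} → PreferredMid u z m′ → m′ ≡ m) → Covers m z
    covers-uniquePreferred u∈S u≢z ¬uz pm@(mid , _) unique =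
      _ , _ , u∈S , distLe-commonNeighbour mid ,
      _ ∷ [] , [] , inj₁ (choosePath-uniquePreferred u≢z ¬uz pm unique)

    isCover : (∀ x y → Adj x y → Covers x y) → Is2SSPUnionCover Adj S
    isCover covers = choosePath , (λ _ _ _ → choosePath-shortest) , covers

module Graded {V : Set} (level : V → ℕ) where

  data Consecutive (x y : V) : Set where
    up   : level y ≡ suc (level x) → Consecutive x y
    down : level x ≡ suc (level y) → Consecutive x y

  data TwoApart (u z : V) : Set where
    up   : level z ≡ 2 + level u → TwoApart u z
    down : level u ≡ 2 + level z → TwoApart u z

  consecutive-sym : ∀ {x y} → Consecutive x y → Consecutive y x
  consecutive-sym (up e)   = down e
  consecutive-sym (down e) = up e

  consecutive⇒≢ : ∀ {x y} → Consecutive x y → x ≢ y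
  consecutive⇒≢ (up e)   refl = 1+n≢n (sym e)
  consecutive⇒≢ (down e) refl = 1+n≢n (sym e)

  twoApart⇒≢ : ∀ {u z} → TwoApart u z → u ≢ z
  twoApart⇒≢ (up e)   refl = m≢1+n+m _ {1} e
  twoApart⇒≢ (down e) refl = m≢1+n+m _ {1} e

  twoApart⇒¬consecutive : ∀ {u z} → TwoApart u z → ¬ Consecutive u z
  twoApart⇒¬consecutive (up e)   (up c)   = m≢1+n+m _ {0} (trans (sym c) e)
  twoApart⇒¬consecutive (up e)   (down c) = m≢1+n+m _ {2} (trans c (cong suc e))
  twoApart⇒¬consecutive (down e) (up c)   = m≢1+n+m _ {2} (trans c (cong suc e))
  twoApart⇒¬consecutive (down e) (down c) = m≢1+n+m _ {0} (trans (sym c) e)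

  middle-level : ∀ {u m z} → level z ≡ 2 + level u →
    Consecutive u m → Consecutive m z → level m ≡ suc (level u)
  middle-level e (up um)   (up mz)   = um
  middle-level e (up um)   (down zm) =
    ⊥-elim (m≢1+n+m _ {1} (trans (sym um) (trans zm (cong suc e))))
  middle-level e (down mu) (up mz)   =
    ⊥-elim (m≢1+n+m _ {1} (trans (trans mu (sym mz)) e))
  middle-level e (down mu) (down zm) =
    ⊥-elim (m≢1+n+m _ {3} (trans mu (cong suc (trans zm (cong suc e)))))

  twoApart-middle : ∀ {u z m m′} → TwoApart u z →
    Consecutive u m → Consecutive m z → Consecutive u m′ → Consecutive m′ z → level m ≡ level m′
  twoApart-middle (up e) um mz um′ m′z =
    trans (middle-level e um mz) (sym (middle-level e um′ m′z))
  twoApart-middle (down e) um mz um′ m′z =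
    trans (middle-level e (consecutive-sym mz) (consecutive-sym um))
          (sym (middle-level e (consecutive-sym m′z) (consecutive-sym um′)))

module Benes (r : ℕ) where

  V : Set
  V = BenesV r

  Adj : V → V → Set
  Adj = BenesAdj r

  level : V → ℕ
  level (_ , i) = toℕ i

  open Graded level

  adj⇒consecutive : ∀ {x y} → Adj x y → Consecutive x y
  adj⇒consecutive (inj₁ (e , _)) = up e
  adj⇒consecutive (inj₂ (e , _)) = down e

  adj-sym : ∀ {x y} → Adj x y → Adj y x
  adj-sym = swap

  straight : ∀ {w i j} → toℕ j ≡ suc (toℕ i) → Adj (w , i) (w , j)
  straight e = inj₁ (e , inj₁ refl)

  vertex-≡ : ∀ {x y : V} → proj₁ x ≡ proj₁ y → level x ≡ level y → x ≡ y
  vertex-≡ {w , i} {.w , j} refl e = cong (w ,_) (toℕ-injective e)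

  _≟W_ : DecidableEquality (Vec Bool r)
  _≟W_ = ≡-decVec _≟B_

  _≟_ : DecidableEquality V
  _≟_ = ≡-dec× _≟W_ _≟F_

  diffExactlyAt? : ∀ (w w′ : Vec Bool r) m → Dec (DiffExactlyAt w w′ m)
  diffExactlyAt? w w′ m = all? λ k →
    ((toℕ k ≟ℕ m) →-dec ¬? (lookup w k ≟B lookup w′ k)) ×-dec
    (¬? (toℕ k ≟ℕ m) →-dec (lookup w k ≟B lookup w′ k))

  arc? : Decidable (BenesArc r)
  arc? (w , i) (w′ , j) = (toℕ j ≟ℕ suc (toℕ i)) ×-dec
    ((w′ ≟W w) ⊎-dec diffExactlyAt? w w′ (flipIndex r (toℕ i)))

  adj? : Decidable Adj
  adj? x y = arc? x y ⊎-dec arc? y x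

  search : ∀ {P : Pred V 0ℓ} → Decidable₁ P → Dec (∃ P)
  search P? = map′ (λ (w , i , p) → (w , i) , p) (λ ((w , i) , p) → w , i , p)
                   (anySubset? λ w → any? λ i → P? (w , i))

  SameWord : V → V → V → Set
  SameWord u _ m = proj₁ m ≡ proj₁ u

  open ShortestPathChoice Adj _≟_ adj? search SameWord (λ u _ m → proj₁ m ≟W proj₁ u) public

  anchorLevel< : ∀ {k} → k < ⌈ r /2⌉ → 2 + k * 4 < suc (r + r)
  anchorLevel< {k} k<⌈r/2⌉ = s≤s (subst (_≤ r + r) (sym (2+m*4≡[1+m+m]+[1+m+m] k))
    (+-mono-≤ (m<⌈n/2⌉⇒m+m<n k<⌈r/2⌉) (m<⌈n/2⌉⇒m+m<n k<⌈r/2⌉)))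

  quotient<⌈r/2⌉ : ∀ {i} (d : DivMod i 4) → i < r + r → DivMod.quotient d < ⌈ r /2⌉
  quotient<⌈r/2⌉ (result k ρ i≡ρ+k*4) i<r+r = m+m<n⇒m<⌈n/2⌉ (≰⇒> λ r≤k+k →
    <⇒≱ k*4<r+r (subst (r + r ≤_) (sym (m*4≡[m+m]+[m+m] k)) (+-mono-≤ r≤k+k r≤k+k)))
    where
      k*4<r+r : k * 4 < r + r
      k*4<r+r = ≤-<-trans (m≤n+m (k * 4) (toℕ ρ)) (subst (_< r + r) i≡ρ+k*4 i<r+r)

  anchorLevel : Fin ⌈ r /2⌉ → Fin (suc (r + r))
  anchorLevel k = fromℕ< (anchorLevel< (toℕ<n k))

  anchor : Vec Bool r → Fin ⌈ r /2⌉ → V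
  anchor w k = w , anchorLevel k

  anchors : List V
  anchors = cartesianProductWith anchor (allWords r) (allFin ⌈ r /2⌉)

  anchor-injective : ∀ {w w′ k k′} → anchor w k ≡ anchor w′ k′ → w ≡ w′ × k ≡ k′
  anchor-injective {k = k} {k′} e = ,-injectiveˡ e , toℕ-injective (*-cancelʳ-≡ _ _ 4
    (+-cancelˡ-≡ 2 _ _ (trans (sym (toℕ-fromℕ< (anchorLevel< (toℕ<n k))))
      (trans (cong toℕ (,-injectiveʳ e)) (toℕ-fromℕ< (anchorLevel< (toℕ<n k′)))))))

  anchors-unique : Unique anchors
  anchors-unique = Unique.cartesianProductWith⁺ anchor anchor-injective
    (allWords-unique r) (Unique.allFin⁺ ⌈ r /2⌉)

  length-anchors : length anchors ≡ ⌈ r /2⌉ * 2 ^ r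
  length-anchors = trans (length-cartesianProductWith anchor (allWords r) (allFin ⌈ r /2⌉))
    (trans (cong₂ _*_ (length-allWords r) (length-tabulate {n = ⌈ r /2⌉} (λ k → k)))
           (*-comm (2 ^ r) ⌈ r /2⌉))

  anchor-∈ : ∀ w {k} → k < ⌈ r /2⌉ → ∃ λ ℓ → toℕ ℓ ≡ 2 + k * 4 × (w , ℓ) ∈ anchors
  anchor-∈ w k<⌈r/2⌉ = anchorLevel k′ ,
    trans (toℕ-fromℕ< (anchorLevel< (toℕ<n k′))) (cong (λ k → 2 + k * 4) (toℕ-fromℕ< k<⌈r/2⌉)) ,
    ∈-cartesianProductWith⁺ anchor (∈-allWords w) (∈-allFin k′)
    where k′ = fromℕ< k<⌈r/2⌉

  open Covering anchors public

  covers-straight : ∀ {u m z} → u ∈ anchors → Adj u m → Adj m z → SameWord u z m →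
    TwoApart u z → Covers m z
  covers-straight {u} {m} {z} u∈ um mz same apart =
    covers-uniquePreferred u∈ (twoApart⇒≢ apart)
      (λ uz → twoApart⇒¬consecutive apart (adj⇒consecutive uz)) ((um , mz) , same) unique
    where
      unique : ∀ {m′} → PreferredMid u z m′ → m′ ≡ m
      unique ((um′ , m′z) , same′) = vertex-≡ (trans same′ (sym same))
        (twoApart-middle apart (adj⇒consecutive um′) (adj⇒consecutive m′z)
                               (adj⇒consecutive um) (adj⇒consecutive mz))

  covers-arc : ∀ {x y} → BenesArc r x y → Covers x y
  covers-arc {w , i} {w′ , j} arc@(j≡1+i , _) = byRemainder (toℕ i divMod 4)
    where
      xy : Adj (w , i) (w′ , j)
      xy = inj₁ arc

      i<r+r : toℕ i < r + r
      i<r+r = subst (_≤ r + r) j≡1+i (≤-pred (toℕ<n j))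

      byRemainder : DivMod (toℕ i) 4 → Covers (w , i) (w′ , j)
      byRemainder d@(result k 0F i≡k*4) =
        let ℓ , ℓ≡2+k*4 , u∈ = anchor-∈ w′ (quotient<⌈r/2⌉ d i<r+r)
            ℓ≡2+i = trans ℓ≡2+k*4 (cong (2 +_) (sym i≡k*4))
            uy = adj-sym (straight (trans ℓ≡2+i (cong suc (sym j≡1+i))))
        in covers-sym (covers-straight u∈ uy (adj-sym xy) refl (down ℓ≡2+i))
      byRemainder d@(result k 1F i≡1+k*4) =
        let ℓ , ℓ≡2+k*4 , u∈ = anchor-∈ w′ (quotient<⌈r/2⌉ d i<r+r)
            y∈ = subst (_∈ anchors)
                   (vertex-≡ refl (trans ℓ≡2+k*4 (sym (trans j≡1+i (cong suc i≡1+k*4))))) u∈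
            yx = adj-sym xy
        in covers-sym (covers-incident y∈ (consecutive⇒≢ (adj⇒consecutive yx)) yx)
      byRemainder d@(result k 2F i≡2+k*4) =
        let ℓ , ℓ≡2+k*4 , u∈ = anchor-∈ w (quotient<⌈r/2⌉ d i<r+r)
            x∈ = subst (_∈ anchors) (vertex-≡ refl (trans ℓ≡2+k*4 (sym i≡2+k*4))) u∈
        in covers-incident x∈ (consecutive⇒≢ (adj⇒consecutive xy)) xy
      byRemainder d@(result k 3F i≡3+k*4) =
        let ℓ , ℓ≡2+k*4 , u∈ = anchor-∈ w (quotient<⌈r/2⌉ d i<r+r)
            i≡1+ℓ = trans i≡3+k*4 (cong suc (sym ℓ≡2+k*4))
        in covers-straight u∈ (straight i≡1+ℓ) xy refl (up (trans j≡1+i (cong suc i≡1+ℓ)))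

  covers : ∀ x y → Adj x y → Covers x y
  covers _ _ (inj₁ xy) = covers-arc xy
  covers _ _ (inj₂ yx) = covers-sym (covers-arc yx)

mainTheorem13 : (r : ℕ) → 1 ≤ r → SSPC2U≤ (BenesAdj r) (⌈ r /2⌉ * 2 ^ r)
mainTheorem13 r _ = anchors , anchors-unique , isCover covers , ≤-reflexive length-anchors
  where open Benes r
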